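{- Let $m\in\mathbb{N}$, $k,d\in\mathbb{N}\cup\{0\}$, and let $a,b\in[m]$ be distinct with $a+kd\le m$ and $b+kd\le m$. Then $P^a_{(m,k,d)}\sim_s P^b_{(m,k,d)}$; that is, for every Ferrers board $\lambda$, the number of transversals of $\lambda$ avoiding every POP in $P^a_{(m,k,d)}$ equals the number of transversals of $\lambda$ avoiding every POP in $P^b_{(m,k,d)}$.
   Context: For $m\in\mathbb{N}$ and $c\in[m]=\{1,\dots,m\}$, let $Q^{(m)}_c$ denote the claw-shaped partially ordered pattern (POP) on the labels $1,\dots,m$ in which $c$ is greater than every other label and the other labels are pairwise incomparable. For $a\in\mathbb{N}$, $k,d\in\mathbb{N}\cup\{0\}$ with $a+kd\le m$, let $P^a_{(m,k,d)}=\{Q^{(m)}_{a+jd}: 0\le j\le k\}$. Ferrers boards: number rows $1,\dots,n$ from bottom to top and columns $1,\dots,n$ from left to right. A Ferrers board $\lambda$ (with $n$ rows and $n$ columns) is a set of cells $(r,c)$, $r,c\in[n]$, such that each row is left-justified and row lengths weakly decrease from bottom to top (i.e. if $(r,c)\in\lambda$, $r'\le r$, $c'\le c$ then $(r',c')\in\lambda$), with every row and column nonempty. A transversal of $\lambda$ is a 0–1 filling of the cells of $\lambda$ with exactly one $1$ in each row and each column. A transversal $T$ of $\lambda$ contains the POP $Q^{(m)}_c$ if there are columns $c_1<c_2<\dots<c_m$ such that, letting $r_j$ be the row of the $1$ of $T$ in column $c_j$, we have $r_c>r_j$ for all $j\ne c$, and every cell $(r_i,c_j)$ with $i,j\in[m]$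 lies in $\lambda$. (Equivalently, $T$ contains some classical pattern $\alpha\in S_m$ with $\alpha_c=m$, where containment of $\alpha$ requires the rows and columns of the occurrence to induce a copy of the permutation matrix of $\alpha$ all of whose cells lie in $\lambda$.) $T$ avoids a set $P$ of POPs if it contains none of them; $S_\lambda(P)$ denotes the set of transversals of $\lambda$ avoiding $P$. Two sets $P_1,P_2$ are shape-Wilf-equivalent, $P_1\sim_s P_2$, if $|S_\lambda(P_1)|=|S_\lambda(P_2)|$ for every Ferrers board $\lambda$. -}

module Defs where

open import Data.Nat using (ℕ; zero; suc; _+_; _*_; _≤_; _<_; _<ᵇ_; _≡ᵇ_)
open import Data.Bool using (Bool; true; false; _∧_; _∨_; not)
open import Data.Fin using (Fin; toℕ)
open import Data.List using (List; []; _∷_; _++_; map; filter; length; upTo; zip; concatMap; allFin)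
open import Data.Bool.ListAction using (all; any)
open import Data.Vec as V using (Vec; lookup)
open import Data.Product using (Σ; ∃; _×_; _,_; proj₁; proj₂)
open import Relation.Binary.PropositionalEquality using (_≡_)
open import Relation.Nullary.Decidable using (does)
open import Data.Bool.Properties using (T?)
open import Data.Bool using (T)

-- Rows and columns are indexed by Fin n, 0-based: row index 0 is the
-- bottom row (row 1 of the paper), column index 0 is the leftmost column.
-- A board is given by its row lengths len : Fin n → ℕ; cell (r , c) lies
-- in the board iff toℕ c < len r (rows are left-justified).

record Ferrers (n : ℕ) : Set where
  field
    len        : Fin n → ℕ
    len≤n      : ∀ r → len r ≤ n
    decreasing : ∀ r r' → toℕ r ≤ toℕ r' → len r' ≤ len r
    rowNonempty : ∀ r → 1 ≤ len r
    colNonempty : ∀ (c : Fin n) → ∃ λ (r : Fin n) → toℕ c < len r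
open Ferrers public

inBoard : ∀ {n} → Ferrers n → Fin n → Fin n → Bool
inBoard λb r c = toℕ c <ᵇ len λb r

-- Fillings: a candidate transversal is a vector T : Vec (Fin n) n with
-- lookup T c = the row of the 1 in column c.

allVecs : ∀ {A : Set} → List A → (k : ℕ) → List (Vec A k)
allVecs xs zero    = V.[] ∷ []
allVecs xs (suc k) = concatMap (λ x → map (x V.∷_) (allVecs xs k)) xs

finEq : ∀ {n} → Fin n → Fin n → Bool
finEq i j = toℕ i ≡ᵇ toℕ j

-- exactly one 1 in every row and column (injective hence bijective),
-- and all 1s inside the board
isTransversal : ∀ {n} → Ferrers n → Vec (Fin n) n → Bool
isTransversal {n} λb T =
  all (λ c → inBoard λb (lookup T c) c) (allFin n) ∧
  all (λ c → all (λ c' → finEq c c' ∨ not (finEq (lookup T c) (lookup T c')))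
                 (allFin n))
      (allFin n)

transversals : ∀ {n} → Ferrers n → List (Vec (Fin n) n)
transversals {n} λb = filter (λ T → T? (isTransversal λb T)) (allVecs (allFin n) n)

choose : ∀ {A : Set} → ℕ → List A → List (List A)
choose zero    xs       = [] ∷ []
choose (suc m) []       = []
choose (suc m) (x ∷ xs) = map (x ∷_) (choose m xs) ++ choose (suc m) xs

-- Containment of the claw POP Q^(m)_c (c is 1-based, labels 1..m):
-- columns c_1 < ... < c_m, rows r_j = T(c_j), with r_c > r_j for j ≠ c,
-- and every cell (r_i , c_j) lies in the board.
containsQ : ∀ {n} → Ferrers n → Vec (Fin n) n → (m c : ℕ) → Bool
containsQ {n} λb T m c = any occ (choose m (allFin n))
  where
  occ : List (Fin n) → Bool
  occ cs =
    let rs  = map (lookup T) cs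
        irs = zip (map suc (upTo m)) rs
    in  any (λ ir → (proj₁ ir ≡ᵇ c) ∧
                    all (λ jr → (proj₁ jr ≡ᵇ c) ∨ (toℕ (proj₂ jr) <ᵇ toℕ (proj₂ ir))) irs)
            irs
        ∧ all (λ r → all (λ cj → inBoard λb r cj) cs) rs

-- the set P^a_(m,k,d) = { Q^(m)_(a + j d) : 0 ≤ j ≤ k }, given by its centres
centres : (m k d a : ℕ) → List ℕ
centres m k d a = map (λ j → a + j * d) (upTo (suc k))

avoidsAll : ∀ {n} → Ferrers n → (m : ℕ) → List ℕ → Vec (Fin n) n → Bool
avoidsAll λb m cs T = all (λ c → not (containsQ λb T m c)) cs

countAvoid : ∀ {n} → Ferrers n → (m k d a : ℕ) → ℕ
countAvoid λb m k d a =
  length (filter (λ T → T? (avoidsAll λb m (centres m k d a) T)) (transversals λb))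

-- Let the top row of λ have length L and let the 1 of a transversal T in it
-- lie in column x. Deleting the top row and column x leaves a transversal of a board λ′
-- (every row is at least as long as the top one, so every row loses one cell), and T
-- contains Q^(m)_c iff its restriction to λ′ does or the top 1 centres an occurrence; the
-- latter happens iff the c - 1 columns left of x and the m - c columns right of x fit into
-- the top row, i.e. iff c - 1 ≤ x ≤ L - 1 - (m - c). Hence |S_λ(P)| = N ⋅ |S_λ′(P)|, where
-- N is the number of columns x < L forbidden by no centre of P. Moving every centre right by
-- s = b - a moves the forbidden columns right by s while keeping them inside [0, L), so N
-- is the same for P^a and P^b, and induction on the number of rows concludes. The argument
-- works for any set of centres shifted inside [1, m].

{-# OPTIONS --safe #-}
module Submission where

open import Defs
open import Data.Bool using (Bool; true; false; _∧_; _∨_; not; T)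
open import Data.Bool.ListAction using (all; any; or)
open import Data.Bool.Properties using (T?; T-∧; T-∨; T-≡; T-not-≡)
open import Data.Empty using (⊥-elim)
open import Data.Fin as Fin using (Fin; toℕ; fromℕ; inject₁; punchIn)
import Data.Fin.Properties as Fin
open import Data.List using (List; []; _∷_; _++_; map; concatMap; zip; tabulate; filter; length; upTo; applyUpTo; allFin; cartesianProduct; cartesianProductWith)
import Data.List.Properties as List
open import Data.List.Properties using (map-∘; map-cong; length-map; length-++; length-applyUpTo; filter-++; filter-none; map-upTo; map-++)
open import Data.List.Membership.Propositional using (_∈_; _∉_; find; lose)
open import Data.List.Membership.Propositional.Properties
open import Data.List.Membership.Propositional.Properties.WithK using (unique∧set⇒bag)
open import Data.List.Relation.Binary.BagAndSetEquality using (∼bag⇒↭; _∼[_]_; set)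
open import Data.List.Relation.Binary.Permutation.Propositional.Properties using (↭-length)
open import Data.List.Relation.Binary.Sublist.Propositional using (_⊆_; []; _∷_; _∷ʳ_; minimum)
open import Data.List.Relation.Binary.Sublist.Propositional.Properties using (All-resp-⊆)
open import Data.List.Relation.Unary.All as All using (All; []; _∷_)
import Data.List.Relation.Unary.All.Properties as All
open import Data.List.Relation.Unary.AllPairs as AllPairs using (AllPairs; []; _∷_)
import Data.List.Relation.Unary.AllPairs.Properties as AllPairs
open import Data.List.Relation.Unary.Any as Any using (here; there)
open import Data.List.Relation.Unary.Any.Properties using (any⁺; any⁻)
open import Data.List.Relation.Unary.Unique.Propositional using (Unique)
import Data.List.Relation.Unary.Unique.Propositional.Properties as Unique
open import Data.Nat using (ℕ; zero; suc; pred; >-nonZero; _+_; _*_; _∸_; _≤_; _<_; _≤?_; _<?_; _≟_; _<ᵇ_; _≤ᵇ_; _≡ᵇ_; z≤n; s≤s)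
open import Data.Nat.Properties
open import Data.Product as Product using (∃; _×_; _,_; proj₁; proj₂)
open import Data.Sum as Sum using (_⊎_; inj₁; inj₂)
open import Data.Vec as V using (Vec; lookup)
import Data.Vec.Properties as V
open import Function using (_∘_; _⇔_; mk⇔; Injective; case_of_)
open import Function.Bundles using (module Equivalence)
open Equivalence using (to; from)
open import Relation.Binary.Definitions using (Irreflexive; Transitive)
open import Relation.Binary.PropositionalEquality
open import Relation.Nullary using (¬_; contradiction; yes; no)

-- Counting

count : {A : Set} → (A → Bool) → List A → ℕ
count p xs = length (filter (λ x → T? (p x)) xs)

module _ {A : Set} where

  count-++ : (p : A → Bool) (xs ys : List A) → count p (xs ++ ys) ≡ count p xs + count p ys
  count-++ p xs ys = trans (cong length (filter-++ (λ x → T? (p x)) xs ys)) (length-++ (filter _ xs))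

  count-none : (p : A → Bool) (xs : List A) → (∀ {x} → x ∈ xs → ¬ T (p x)) → count p xs ≡ 0
  count-none p xs none = cong length (filter-none (λ x → T? (p x)) (All.tabulate none))

  count-cong : {p q : A → Bool} (xs : List A) → (∀ {x} → x ∈ xs → p x ≡ q x) → count p xs ≡ count q xs
  count-cong [] eq = refl
  count-cong {p} {q} (x ∷ xs) eq with p x | q x | eq (here refl)
  ... | true  | true  | refl = cong suc (count-cong xs (eq ∘ there))
  ... | false | false | refl = count-cong xs (eq ∘ there)

  count-filter : (p q : A → Bool) (xs : List A) →
                 count q (filter (λ x → T? (p x)) xs) ≡ count (λ x → p x ∧ q x) xs
  count-filter p q [] = refl
  count-filter p q (x ∷ xs) with p x
  ... | false = count-filter p q xs
  ... | true with q x
  ...   | true  = cong suc (count-filter p q xs)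
  ...   | false = count-filter p q xs

  count-complement : (p : A → Bool) (xs : List A) → count p xs + count (not ∘ p) xs ≡ length xs
  count-complement p [] = refl
  count-complement p (x ∷ xs) with p x
  ... | true  = cong suc (count-complement p xs)
  ... | false = trans (+-suc _ _) (cong suc (count-complement p xs))

count-map : {A B : Set} (p : B → Bool) (f : A → B) (xs : List A) → count p (map f xs) ≡ count (p ∘ f) xs
count-map p f []       = refl
count-map p f (x ∷ xs) with p (f x)
... | true  = cong suc (count-map p f xs)
... | false = count-map p f xs

module _ {A B : Set} where

  count-cartesianProduct : (p : A → Bool) (q : B → Bool) (xs : List A) (ys : List B) →
    count (λ z → p (proj₁ z) ∧ q (proj₂ z)) (cartesianProduct xs ys) ≡ count p xs * count q ys
  count-cartesianProduct p q [] ys = refl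
  count-cartesianProduct p q (x ∷ xs) ys = begin
    count pq (map (x ,_) ys ++ cartesianProduct xs ys)
      ≡⟨ count-++ pq (map (x ,_) ys) _ ⟩
    count pq (map (x ,_) ys) + count pq (cartesianProduct xs ys)
      ≡⟨ cong₂ _+_ (count-map pq (x ,_) ys) (count-cartesianProduct p q xs ys) ⟩
    count (λ y → p x ∧ q y) ys + count p xs * count q ys
      ≡⟨ first-row ⟩
    count p (x ∷ xs) * count q ys ∎
    where
    open ≡-Reasoning
    pq = λ z → p (proj₁ z) ∧ q (proj₂ z)
    first-row : count (λ y → p x ∧ q y) ys + count p xs * count q ys ≡ count p (x ∷ xs) * count q ys
    first-row with p x
    ... | true  = refl
    ... | false = cong (_+ count p xs * count q ys) (count-none (λ _ → false) ys λ _ ())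

  count-bijection : (p : A → Bool) (q : B → Bool) {xs : List A} {ys : List B} →
    Unique xs → Unique ys → (∀ a → a ∈ xs) → (∀ b → b ∈ ys) →
    (f : A → B) (g : B → A) →
    (∀ a → T (p a) → T (q (f a)) × g (f a) ≡ a) →
    (∀ b → T (q b) → T (p (g b)) × f (g b) ≡ b) →
    count p xs ≡ count q ys
  count-bijection p q {xs} {ys} xs! ys! ∈xs ∈ys f g f-ok g-ok =
    trans (sym (length-map f P)) (↭-length (∼bag⇒↭ (unique∧set⇒bag fP! Q! fP≈Q)))
    where
    P = filter (λ a → T? (p a)) xs
    Q = filter (λ b → T? (q b)) ys
    p-of : ∀ {a} → a ∈ P → T (p a)
    p-of a∈P = proj₂ (∈-filter⁻ (λ a → T? (p a)) {xs = xs} a∈P)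
    q-of : ∀ {b} → b ∈ Q → T (q b)
    q-of b∈Q = proj₂ (∈-filter⁻ (λ b → T? (q b)) {xs = ys} b∈Q)
    g∘f-on : ∀ as → (∀ {a} → a ∈ as → T (p a)) → map g (map f as) ≡ as
    g∘f-on []       _  = refl
    g∘f-on (a ∷ as) pa = cong₂ _∷_ (proj₂ (f-ok a (pa (here refl)))) (g∘f-on as (pa ∘ there))
    fP! : Unique (map f P)
    fP! = Unique.map⁻ (subst Unique (sym (g∘f-on P p-of)) (Unique.filter⁺ (λ a → T? (p a)) xs!))
    Q! : Unique Q
    Q! = Unique.filter⁺ (λ b → T? (q b)) ys!
    fP⊆Q : ∀ {b} → b ∈ map f P → b ∈ Q
    fP⊆Q b∈fP with a , a∈P , refl ← ∈-map⁻ f b∈fP =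
      ∈-filter⁺ (λ b → T? (q b)) (∈ys (f a)) (proj₁ (f-ok a (p-of a∈P)))
    Q⊆fP : ∀ {b} → b ∈ Q → b ∈ map f P
    Q⊆fP {b} b∈Q with pgb , fgb≡b ← g-ok b (q-of b∈Q) =
      subst (_∈ map f P) fgb≡b (∈-map⁺ f (∈-filter⁺ (λ a → T? (p a)) (∈xs (g b)) pgb))
    fP≈Q : map f P ∼[ set ] Q
    fP≈Q = mk⇔ fP⊆Q Q⊆fP

module _ {A : Set} (xs : List A) where

  allVecs-suc : ∀ k → allVecs xs (suc k) ≡ cartesianProductWith V._∷_ xs (allVecs xs k)
  allVecs-suc k = go xs
    where
    go : ∀ ys → concatMap (λ x → map (x V.∷_) (allVecs xs k)) ys
              ≡ cartesianProductWith V._∷_ ys (allVecs xs k)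
    go []       = refl
    go (y ∷ ys) = cong (map (y V.∷_) (allVecs xs k) ++_) (go ys)

  ∈-allVecs : (∀ x → x ∈ xs) → ∀ {k} (v : Vec A k) → v ∈ allVecs xs k
  ∈-allVecs ∈xs V.[]       = here refl
  ∈-allVecs ∈xs (x V.∷ v) = subst ((x V.∷ v) ∈_) (sym (allVecs-suc _))
    (∈-cartesianProductWith⁺ V._∷_ (∈xs x) (∈-allVecs ∈xs v))

  allVecs-unique : Unique xs → ∀ k → Unique (allVecs xs k)
  allVecs-unique xs! zero    = [] ∷ []
  allVecs-unique xs! (suc k) = subst Unique (sym (allVecs-suc k))
    (Unique.cartesianProductWith⁺ V._∷_ V.∷-injective xs! (allVecs-unique xs! k))

applyUpTo-+ : {A : Set} (f : ℕ → A) (i j : ℕ) →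
              applyUpTo f (i + j) ≡ applyUpTo f i ++ applyUpTo (f ∘ (i +_)) j
applyUpTo-+ f zero    j = refl
applyUpTo-+ f (suc i) j = cong (f 0 ∷_) (applyUpTo-+ (f ∘ suc) i j)

count-upTo-+ : (p : ℕ → Bool) (i j : ℕ) →
               count p (upTo (i + j)) ≡ count p (upTo i) + count (p ∘ (i +_)) (upTo j)
count-upTo-+ p i j = begin
  count p (upTo (i + j))                                ≡⟨ cong (count p) (applyUpTo-+ (λ v → v) i j) ⟩
  count p (upTo i ++ applyUpTo (i +_) j)                ≡⟨ count-++ p (upTo i) _ ⟩
  count p (upTo i) + count p (applyUpTo (i +_) j)       ≡⟨ cong (λ vs → count p (upTo i) + count p vs) (sym (map-upTo (i +_) j)) ⟩
  count p (upTo i) + count p (map (i +_) (upTo j))      ≡⟨ cong (count p (upTo i) +_) (count-map p (i +_) (upTo j)) ⟩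
  count p (upTo i) + count (p ∘ (i +_)) (upTo j)        ∎
  where open ≡-Reasoning

count-upTo-translate : (p q : ℕ → Bool) (s L : ℕ) →
  (∀ v → q (s + v) ≡ p v) → (∀ v → T (q v) → s ≤ v) → (∀ v → T (p v) → s + v < L) →
  count p (upTo L) ≡ count q (upTo L)
count-upTo-translate p q s L q≡p q≥s p<L with s ≤? L
... | no s≰L = trans (count-none p (upTo L) λ {v} v<L pv → s≰L (≤-trans (m≤m+n s v) (<⇒≤ (p<L v pv))))
                     (sym (count-none q (upTo L) λ {v} v<L qv → s≰L (≤-trans (q≥s v qv) (<⇒≤ (∈-upTo⁻ v<L)))))
... | yes s≤L = begin
  count p (upTo L)                                  ≡⟨ cong (count p ∘ upTo) (sym (trans (+-comm t s) (m+[n∸m]≡n s≤L))) ⟩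
  count p (upTo (t + s))                            ≡⟨ count-upTo-+ p t s ⟩
  count p (upTo t) + count (p ∘ (t +_)) (upTo s)    ≡⟨ cong (count p (upTo t) +_) (count-none (p ∘ (t +_)) (upTo s) beyond) ⟩
  count p (upTo t) + 0                              ≡⟨ +-identityʳ _ ⟩
  count p (upTo t)                                  ≡⟨ count-cong (upTo t) (λ {v} _ → sym (q≡p v)) ⟩
  count (q ∘ (s +_)) (upTo t)                       ≡⟨ cong (_+ count (q ∘ (s +_)) (upTo t)) (sym (count-none q (upTo s) below)) ⟩
  count q (upTo s) + count (q ∘ (s +_)) (upTo t)    ≡⟨ count-upTo-+ q s t ⟨
  count q (upTo (s + t))                            ≡⟨ cong (count q ∘ upTo) (m+[n∸m]≡n s≤L) ⟩
  count q (upTo L)                                  ∎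
  where
  open ≡-Reasoning
  t = L ∸ s
  beyond : ∀ {v} → v ∈ upTo s → ¬ T (p (t + v))
  beyond {v} _ ptv = <⇒≱ (p<L (t + v) ptv)
    (≤-trans (≤-reflexive (sym (m+[n∸m]≡n s≤L))) (+-monoʳ-≤ s (m≤m+n t v)))
  below : ∀ {v} → v ∈ upTo s → ¬ T (q v)
  below v<s qv = <⇒≱ (∈-upTo⁻ v<s) (q≥s _ qv)

-- Sublists, windows and labels

module _ {A : Set} where

  ∈-choose⁻ : ∀ m (xs : List A) {cs} → cs ∈ choose m xs → cs ⊆ xs × length cs ≡ m
  ∈-choose⁻ zero    xs       (here refl) = minimum xs , refl
  ∈-choose⁻ (suc m) (x ∷ xs) cs∈ with ∈-++⁻ (map (x ∷_) (choose m xs)) cs∈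
  ... | inj₁ cs∈′ with cs′ , cs′∈ , refl ← ∈-map⁻ (x ∷_) cs∈′ =
    let cs′⊆xs , len≡ = ∈-choose⁻ m xs cs′∈ in refl ∷ cs′⊆xs , cong suc len≡
  ... | inj₂ cs∈′ = let cs⊆xs , len≡ = ∈-choose⁻ (suc m) xs cs∈′ in x ∷ʳ cs⊆xs , len≡

  ∈-choose⁺ : {cs xs : List A} → cs ⊆ xs → cs ∈ choose (length cs) xs
  ∈-choose⁺ []                  = here refl
  ∈-choose⁺ {[]}     (x ∷ʳ _)   = here refl
  ∈-choose⁺ {c ∷ cs} (x ∷ʳ c∷cs⊆xs) = ∈-++⁺ʳ (map (x ∷_) (choose (length cs) _)) (∈-choose⁺ c∷cs⊆xs)
  ∈-choose⁺          (refl ∷ cs⊆xs) = ∈-++⁺ˡ (∈-map⁺ (_ ∷_) (∈-choose⁺ cs⊆xs))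

  AllPairs-resp-⊆ : {R : A → A → Set} {xs ys : List A} → xs ⊆ ys → AllPairs R ys → AllPairs R xs
  AllPairs-resp-⊆ []              []           = []
  AllPairs-resp-⊆ (_ ∷ʳ xs⊆ys)    (_ ∷ R-ys)   = AllPairs-resp-⊆ xs⊆ys R-ys
  AllPairs-resp-⊆ (refl ∷ xs⊆ys)  (Ry ∷ R-ys)  = All-resp-⊆ xs⊆ys Ry ∷ AllPairs-resp-⊆ xs⊆ys R-ys

module _ {A : Set} {_≺_ : A → A → Set} (irr : Irreflexive _≡_ _≺_) (tr : Transitive _≺_) where

  private
    ∈-∷-≺ : ∀ {y z ys} → y ≺ z → z ∈ y ∷ ys → z ∈ ys
    ∈-∷-≺ y≺z (here refl)  = contradiction y≺z (irr refl)
    ∈-∷-≺ _   (there z∈ys) = z∈ys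

  sorted-⊆ : {xs ys : List A} → AllPairs _≺_ xs → AllPairs _≺_ ys → (∀ {z} → z ∈ xs → z ∈ ys) → xs ⊆ ys
  sorted-⊆ {[]}     {ys}     _             _           _   = minimum ys
  sorted-⊆ {x ∷ xs} {[]}     _             _           xs⊆ = contradiction (xs⊆ (here refl)) λ ()
  sorted-⊆ {x ∷ xs} {y ∷ ys} (x≺xs ∷ ≺xs) (y≺ys ∷ ≺ys) xs⊆ with xs⊆ (here refl)
  ... | here refl  = refl ∷ sorted-⊆ ≺xs ≺ys (λ z∈xs → ∈-∷-≺ (All.lookup x≺xs z∈xs) (xs⊆ (there z∈xs)))
  ... | there x∈ys = y ∷ʳ sorted-⊆ (x≺xs ∷ ≺xs) ≺ys (λ z∈ → ∈-∷-≺ (y≺ z∈) (xs⊆ z∈))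
    where
    y≺ : ∀ {z} → z ∈ x ∷ xs → y ≺ z
    y≺ (here refl)  = All.lookup y≺ys x∈ys
    y≺ (there z∈xs) = tr (All.lookup y≺ys x∈ys) (All.lookup x≺xs z∈xs)

Increasing : ∀ {n} → List (Fin n) → Set
Increasing = AllPairs Fin._<_

module _ {n : ℕ} where

  allFin-increasing : Increasing (allFin n)
  allFin-increasing = AllPairs.tabulate⁺-< (λ i<j → i<j)

  ∈-choose-allFin⁻ : ∀ m {cs} → cs ∈ choose m (allFin n) → Increasing cs × length cs ≡ m
  ∈-choose-allFin⁻ m cs∈ = let cs⊆ , len≡ = ∈-choose⁻ m _ cs∈ in AllPairs-resp-⊆ cs⊆ allFin-increasing , len≡

  ∈-choose-allFin⁺ : {cs : List (Fin n)} → Increasing cs → cs ∈ choose (length cs) (allFin n)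
  ∈-choose-allFin⁺ inc = ∈-choose⁺ (sorted-⊆ Fin.<-irrefl Fin.<-trans inc allFin-increasing (λ _ → ∈-allFin _))

module _ {A : Set} {R : A → A → Set} where

  AllPairs-middle⁻ : ∀ us {v ws} → AllPairs R (us ++ v ∷ ws) →
                     AllPairs R us × All (λ u → R u v) us × All (R v) ws × AllPairs R ws
  AllPairs-middle⁻ []       (v-ws ∷ ws-inc) = [] , [] , v-ws , ws-inc
  AllPairs-middle⁻ (u ∷ us) (u-rest ∷ rest) =
    let us-inc , us-v , v-ws , ws-inc = AllPairs-middle⁻ us rest
    in  All.++⁻ˡ us u-rest ∷ us-inc , All.head (All.++⁻ʳ us u-rest) ∷ us-v , v-ws , ws-inc

length-increasing-≤ : {A : Set} (f : A → ℕ) {lo hi : ℕ} (xs : List A) → lo ≤ hi →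
                      AllPairs (λ a b → f a < f b) xs → All (λ a → lo ≤ f a × f a < hi) xs →
                      lo + length xs ≤ hi
length-increasing-≤ f {lo} []       lo≤hi _ _ = ≤-trans (≤-reflexive (+-identityʳ lo)) lo≤hi
length-increasing-≤ f {lo} (x ∷ xs) _ (x< ∷ inc) ((lo≤x , x<hi) ∷ bounds) = begin
  lo + suc (length xs)   ≡⟨ +-suc lo (length xs) ⟩
  suc lo + length xs     ≤⟨ +-monoˡ-≤ (length xs) (s≤s lo≤x) ⟩
  suc (f x) + length xs  ≤⟨ length-increasing-≤ f xs x<hi inc (All.zipWith (λ (fx<fy , _ , fy<hi) → fx<fy , fy<hi) (x< , bounds)) ⟩
  _                      ∎
  where open ≤-Reasoning

map-toℕ-onto : ∀ {k} {ns : List ℕ} → All (_< k) ns → ∃ λ (is : List (Fin k)) → map toℕ is ≡ ns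
map-toℕ-onto []          = [] , refl
map-toℕ-onto (v<k ∷ <k) = let is , eq = map-toℕ-onto <k in
  Fin.fromℕ< v<k ∷ is , cong₂ _∷_ (Fin.toℕ-fromℕ< v<k) eq

-- Witness: the consecutive numbers x - p, …, x + q.
window : ∀ x p q → p ≤ x → ∃ λ us → ∃ λ ws →
         length us ≡ p × length ws ≡ q × AllPairs _<_ (us ++ x ∷ ws) × All (_≤ x + q) (us ++ x ∷ ws)
window x p q p≤x =
  applyUpTo f p , applyUpTo (f ∘ (p +_) ∘ suc) q , length-applyUpTo f p , length-applyUpTo _ q ,
  subst (AllPairs _<_) around-x (AllPairs.applyUpTo⁺₁ f (p + suc q) (λ i<j _ → +-monoʳ-< (x ∸ p) i<j)) ,
  subst (All (_≤ x + q)) around-x (All.applyUpTo⁺₁ f (p + suc q) (λ i<p+suc[q] → ≤-pred (begin-strict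
    f _                  <⟨ +-monoʳ-< (x ∸ p) i<p+suc[q] ⟩
    x ∸ p + (p + suc q)  ≡⟨ +-assoc (x ∸ p) p (suc q) ⟨
    x ∸ p + p + suc q    ≡⟨ cong (_+ suc q) (m∸n+n≡m p≤x) ⟩
    x + suc q            ≡⟨ +-suc x q ⟩
    suc (x + q)          ∎)))
  where
  open ≤-Reasoning
  f : ℕ → ℕ
  f = (x ∸ p) +_
  around-x : applyUpTo f (p + suc q) ≡ applyUpTo f p ++ x ∷ applyUpTo (f ∘ (p +_) ∘ suc) q
  around-x = trans (applyUpTo-+ f p (suc q))
                (cong (λ v → applyUpTo f p ++ v ∷ applyUpTo (f ∘ (p +_) ∘ suc) q) (trans (cong ((x ∸ p) +_) (+-identityʳ p)) (m∸n+n≡m p≤x)))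

fin-window : ∀ {k} (x : Fin k) p q → p ≤ toℕ x → toℕ x + q < k →
            ∃ λ pre → ∃ λ post → length pre ≡ p × length post ≡ q ×
            Increasing (pre ++ x ∷ post) × All (λ j → toℕ j ≤ toℕ x + q) (pre ++ x ∷ post)
fin-window {k} x p q p≤x x+q<k
  with us , ws , |us|≡p , |ws|≡q , inc , ≤x+q ← window (toℕ x) p q p≤x
  with <k ← All.map (λ v≤x+q → ≤-<-trans v≤x+q x+q<k) ≤x+q
  with pre , pre≡ ← map-toℕ-onto (All.++⁻ˡ us <k)
  with post , post≡ ← map-toℕ-onto (All.tail (All.++⁻ʳ us <k)) =
  pre , post , trans (sym (length-map toℕ pre)) (trans (cong length pre≡) |us|≡p) ,
               trans (sym (length-map toℕ post)) (trans (cong length post≡) |ws|≡q) ,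
  AllPairs.map⁻ (subst (AllPairs _<_) (sym toℕs≡) inc) ,
  All.map⁻ (subst (All (_≤ toℕ x + q)) (sym toℕs≡) ≤x+q)
  where
  toℕs≡ : map toℕ (pre ++ x ∷ post) ≡ us ++ toℕ x ∷ ws
  toℕs≡ = trans (map-++ toℕ pre (x ∷ post)) (cong₂ (λ a b → a ++ toℕ x ∷ b) pre≡ post≡)

module _ {A : Set} where

  labelled : (ℕ → ℕ) → List A → List (ℕ × A)
  labelled f vs = zip (applyUpTo f (length vs)) vs

  ∈-labelled⁻ : ∀ f vs {j s} → (j , s) ∈ labelled f vs → s ∈ vs
  ∈-labelled⁻ f (v ∷ vs) (here refl) = here refl
  ∈-labelled⁻ f (v ∷ vs) (there js∈) = there (∈-labelled⁻ (f ∘ suc) vs js∈)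

  ∈-labelled-middle : ∀ f us v ws → (f (length us) , v) ∈ labelled f (us ++ v ∷ ws)
  ∈-labelled-middle f []       v ws = here refl
  ∈-labelled-middle f (u ∷ us) v ws = there (∈-labelled-middle (f ∘ suc) us v ws)

  ∈-labelled-middle⁻ : ∀ f us v ws {j s} → (j , s) ∈ labelled f (us ++ v ∷ ws) →
                       j ≡ f (length us) ⊎ s ∈ us ++ ws
  ∈-labelled-middle⁻ f []       v ws (here refl) = inj₁ refl
  ∈-labelled-middle⁻ f []       v ws (there js∈) = inj₂ (∈-labelled⁻ (f ∘ suc) ws js∈)
  ∈-labelled-middle⁻ f (u ∷ us) v ws (here refl) = inj₂ (here refl)
  ∈-labelled-middle⁻ f (u ∷ us) v ws (there js∈) = Sum.map₂ there (∈-labelled-middle⁻ (f ∘ suc) us v ws js∈)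

labelled-map : {A B : Set} (f : ℕ → ℕ) (g : A → B) (vs : List A) →
               labelled f (map g vs) ≡ map (Product.map₂ g) (labelled f vs)
labelled-map f g []       = refl
labelled-map f g (v ∷ vs) = cong ((f 0 , g v) ∷_) (labelled-map (f ∘ suc) g vs)

-- Vectors and Fin

vec-ext : ∀ {A : Set} {n} {xs ys : Vec A n} → (∀ i → lookup xs i ≡ lookup ys i) → xs ≡ ys
vec-ext {xs = xs} {ys} eq = trans (sym (V.tabulate∘lookup xs)) (trans (V.tabulate-cong eq) (V.tabulate∘lookup ys))

suc<⇒<∸1 : ∀ {a k} → suc a < k → a < k ∸ 1
suc<⇒<∸1 {k = suc k} (s≤s a<k) = a<k

<∸1⇒suc< : ∀ {a k} → a < k ∸ 1 → suc a < k
<∸1⇒suc< {k = suc k} a<k = s≤s a<k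

-- r as an element of Fin n, with the default d standing in for r = n.
lower₁-or : ∀ {n} → Fin n → Fin (suc n) → Fin n
lower₁-or {n} d r with n ≟ toℕ r
... | yes _   = d
... | no n≢r = Fin.lower₁ r n≢r

inject₁-lower₁-or : ∀ {n} (d : Fin n) (r : Fin (suc n)) → toℕ r < n → inject₁ (lower₁-or d r) ≡ r
inject₁-lower₁-or {n} d r r<n with n ≟ toℕ r
... | yes n≡r = contradiction (sym n≡r) (<⇒≢ r<n)
... | no n≢r  = Fin.inject₁-lower₁ r n≢r

lower₁-or-inject₁ : ∀ {n} (d r : Fin n) → lower₁-or d (inject₁ r) ≡ r
lower₁-or-inject₁ d r = Fin.inject₁-injective (inject₁-lower₁-or d (inject₁ r) (Fin.inject₁ℕ< r))

≡-or-punchIn : ∀ {n} (x c : Fin (suc n)) → c ≡ x ⊎ ∃ λ c′ → c ≡ punchIn x c′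
≡-or-punchIn x c with x Fin.≟ c
... | yes refl = inj₁ refl
... | no x≢c   = inj₂ (Fin.punchOut x≢c , sym (Fin.punchIn-punchOut x≢c))

toℕ-punchIn-< : ∀ {n} (x : Fin (suc n)) (c : Fin n) → toℕ c < toℕ x → toℕ (punchIn x c) ≡ toℕ c
toℕ-punchIn-< (Fin.suc x) Fin.zero    _         = refl
toℕ-punchIn-< (Fin.suc x) (Fin.suc c) (s≤s c<x) = cong suc (toℕ-punchIn-< x c c<x)

toℕ-punchIn-≥ : ∀ {n} (x : Fin (suc n)) (c : Fin n) → toℕ x ≤ toℕ c → toℕ (punchIn x c) ≡ suc (toℕ c)
toℕ-punchIn-≥ Fin.zero    c           _         = refl
toℕ-punchIn-≥ (Fin.suc x) (Fin.suc c) (s≤s x≤c) = cong suc (toℕ-punchIn-≥ x c x≤c)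

toℕ-punchIn-≤ : ∀ {n} (x : Fin (suc n)) (c : Fin n) → toℕ (punchIn x c) ≤ suc (toℕ c)
toℕ-punchIn-≤ x c with toℕ c <? toℕ x
... | yes c<x = ≤-trans (≤-reflexive (toℕ-punchIn-< x c c<x)) (n≤1+n _)
... | no c≮x  = ≤-reflexive (toℕ-punchIn-≥ x c (≮⇒≥ c≮x))

inject₁-<⇔ : ∀ {k} {a b : Fin k} → inject₁ a Fin.< inject₁ b ⇔ a Fin.< b
inject₁-<⇔ {a = a} {b} = mk⇔ (subst₂ _<_ (Fin.toℕ-inject₁ a) (Fin.toℕ-inject₁ b))
                             (subst₂ _<_ (sym (Fin.toℕ-inject₁ a)) (sym (Fin.toℕ-inject₁ b)))

punchIn-<⇔ : ∀ {k} (x : Fin (suc k)) {a b : Fin k} → punchIn x a Fin.< punchIn x b ⇔ a Fin.< b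
punchIn-<⇔ x {a} {b} = mk⇔
  (λ lt → ≤∧≢⇒< (Fin.punchIn-cancel-≤ x a b (<⇒≤ lt)) (λ a≡b → <-irrefl (cong (toℕ ∘ punchIn x) (Fin.toℕ-injective a≡b)) lt))
  (λ lt → ≤∧≢⇒< (Fin.punchIn-mono-≤ x a b (<⇒≤ lt)) (λ xa≡xb → <-irrefl (cong toℕ (Fin.punchIn-injective x a b (Fin.toℕ-injective xa≡xb))) lt))

unpunchIn : ∀ {k} (x : Fin (suc k)) {cs} → x ∉ cs → ∃ λ cs′ → cs ≡ map (punchIn x) cs′
unpunchIn x {[]}     _  = [] , refl
unpunchIn x {c ∷ cs} x∉ with ≡-or-punchIn x c | unpunchIn x (x∉ ∘ there)
... | inj₁ refl       | _          = contradiction (here refl) x∉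
... | inj₂ (c′ , refl) | cs′ , refl = c′ ∷ cs′ , refl

-- Boolean reflection

all-allFin⁻ : ∀ {n} (p : Fin n → Bool) → T (all p (allFin n)) → ∀ i → T (p i)
all-allFin⁻ p h i = All.lookup (All.all⁺ p _ h) (∈-allFin i)

all-allFin⁺ : ∀ {n} (p : Fin n → Bool) → (∀ i → T (p i)) → T (all p (allFin n))
all-allFin⁺ {n} p h = All.all⁻ p {allFin n} (All.tabulate (λ {i} _ → h i))

T-finEq : ∀ {n} {i j : Fin n} → T (finEq i j) ⇔ i ≡ j
T-finEq = mk⇔ (Fin.toℕ-injective ∘ ≡ᵇ⇒≡ _ _) (≡⇒≡ᵇ _ _ ∘ cong toℕ)

T-∨-not : ∀ a b → T (a ∨ not b) ⇔ (T b → T a)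
T-∨-not true  _     = mk⇔ (λ _ _ → _) (λ _ → _)
T-∨-not false true  = mk⇔ (λ ()) (λ f → f _)
T-∨-not false false = mk⇔ (λ _ ()) (λ _ → _)

T-injective : ∀ {a b} → T a ⇔ T b → a ≡ b
T-injective {false} {false} _  = refl
T-injective {false} {true}  eq = ⊥-elim (from eq _)
T-injective {true}  {false} eq = ⊥-elim (to eq _)
T-injective {true}  {true}  _  = refl

-- Boards given by their row lengths

-- The definitions of Defs restated for a bare row-length function: deleting the top
-- row and a column can leave an empty row, so the induction cannot stay within Ferrers.
centre : ∀ {k} → ℕ → List (ℕ × Fin k) → Bool
centre c irs = any (λ ir → (proj₁ ir ≡ᵇ c) ∧
                           all (λ jr → (proj₁ jr ≡ᵇ c) ∨ (toℕ (proj₂ jr) <ᵇ toℕ (proj₂ ir))) irs)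
                   irs

RowLengths : ℕ → Set
RowLengths n = Fin n → ℕ

module _ {n : ℕ} (ℓ : RowLengths n) where

  inBoardOf : Fin n → Fin n → Bool
  inBoardOf r c = toℕ c <ᵇ ℓ r

  isTransversalOf : Vec (Fin n) n → Bool
  isTransversalOf π =
    all (λ c → inBoardOf (lookup π c) c) (allFin n) ∧
    all (λ c → all (λ c′ → finEq c c′ ∨ not (finEq (lookup π c) (lookup π c′)))
                   (allFin n))
        (allFin n)

  occurrenceOf : Vec (Fin n) n → (m c : ℕ) → List (Fin n) → Bool
  occurrenceOf π m c cs =
    centre c (zip (map suc (upTo m)) (map (lookup π) cs)) ∧
    all (λ r → all (λ cj → inBoardOf r cj) cs) (map (lookup π) cs)

  containsQOf : Vec (Fin n) n → (m c : ℕ) → Bool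
  containsQOf π m c = any (occurrenceOf π m c) (choose m (allFin n))

  avoidsAllOf : (m : ℕ) → List ℕ → Vec (Fin n) n → Bool
  avoidsAllOf m cs π = all (λ c → not (containsQOf π m c)) cs

  countAvoidOf : (m : ℕ) → List ℕ → ℕ
  countAvoidOf m cs =
    count (avoidsAllOf m cs) (filter (λ π → T? (isTransversalOf π)) (allVecs (allFin n) n))

countAvoid-rowLengths : ∀ {n} (λb : Ferrers n) m k d a →
                        countAvoid λb m k d a ≡ countAvoidOf (len λb) m (centres m k d a)
countAvoid-rowLengths λb m k d a = refl

module _ {n : ℕ} where

  InBoard : RowLengths n → Vec (Fin n) n → Set
  InBoard ℓ π = ∀ c → toℕ c < ℓ (lookup π c)

  IsTransversal : RowLengths n → Vec (Fin n) n → Set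
  IsTransversal ℓ π = InBoard ℓ π × Injective _≡_ _≡_ (lookup π)

  isTransversal⇔ : (ℓ : RowLengths n) (π : Vec (Fin n) n) →
                   T (isTransversalOf ℓ π) ⇔ IsTransversal ℓ π
  isTransversal⇔ ℓ π = mk⇔
    (λ h → let inb , inj = to T-∧ h in
      (λ c → <ᵇ⇒< _ _ (all-allFin⁻ inside inb c)) ,
      (λ {c} {c′} πc≡πc′ → to T-finEq (to (T-∨-not _ (finEq (lookup π c) (lookup π c′)))
                              (all-allFin⁻ (distinct c) (all-allFin⁻ distinctRow inj c) c′)
                              (from T-finEq πc≡πc′))))
    (λ (inb , inj) → from T-∧
      ( all-allFin⁺ inside (λ c → <⇒<ᵇ (inb c))
      , all-allFin⁺ distinctRow (λ c → all-allFin⁺ (distinct c) (λ c′ →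
          from (T-∨-not _ (finEq (lookup π c) (lookup π c′)))
               (λ πc≡πc′ → from T-finEq (inj (to T-finEq πc≡πc′)))))))
    where
    inside : Fin n → Bool
    inside c = inBoardOf ℓ (lookup π c) c
    distinct : Fin n → Fin n → Bool
    distinct c c′ = finEq c c′ ∨ not (finEq (lookup π c) (lookup π c′))
    distinctRow : Fin n → Bool
    distinctRow c = all (distinct c) (allFin n)

module _ {k : ℕ} where

  Centred : ℕ → List (ℕ × Fin k) → Set
  Centred c irs = ∃ λ r → (c , r) ∈ irs × (∀ {j s} → (j , s) ∈ irs → j ≡ c ⊎ s Fin.< r)

  T-centre : ∀ c irs → T (centre c irs) ⇔ Centred c irs
  T-centre c irs = mk⇔
    (λ h → let (i , r) , ir∈ , centred = find (any⁻ _ irs h)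
               i≡c , dominates = to T-∧ centred
           in r , subst (λ i → (i , r) ∈ irs) (≡ᵇ⇒≡ i c i≡c) ir∈ ,
              λ {j} {s} js∈ → Sum.map (≡ᵇ⇒≡ j c) (<ᵇ⇒< _ _) (to T-∨ (All.lookup (All.all⁺ _ irs dominates) js∈)))
    (λ (r , cr∈ , dominated) → any⁺ _ (lose cr∈ (from T-∧ (≡⇒≡ᵇ c c refl ,
       All.all⁻ _ {irs} (All.tabulate (λ {(j , s)} js∈ → from T-∨ (Sum.map (≡⇒≡ᵇ j c) <⇒<ᵇ (dominated js∈))))))))

  centred-middle : ∀ f us v ws → All (Fin._< v) (us ++ ws) → Centred (f (length us)) (labelled f (us ++ v ∷ ws))
  centred-middle f us v ws <v =
    v , ∈-labelled-middle f us v ws , λ {j} {s} js∈ → Sum.map₂ (All.lookup <v) (∈-labelled-middle⁻ f us v ws js∈)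

Centred-map : ∀ {k k′} (g : Fin k → Fin k′) → (∀ {a b} → g a Fin.< g b ⇔ a Fin.< b) →
              ∀ c irs → Centred c (map (Product.map₂ g) irs) ⇔ Centred c irs
Centred-map g g-< c irs = mk⇔
  (λ (r′ , cr′∈ , dominated) → case ∈-map⁻ (Product.map₂ g) cr′∈ of λ where
    ((_ , r) , cr∈ , refl) → r , cr∈ , λ {j} {s} js∈ → Sum.map₂ (to g-<) (dominated (∈-map⁺ (Product.map₂ g) js∈)))
  (λ (r , cr∈ , dominated) → g r , ∈-map⁺ (Product.map₂ g) cr∈ , λ {j} {s} js∈ → case ∈-map⁻ (Product.map₂ g) js∈ of λ where
    (_ , js∈′ , refl) → Sum.map₂ (from g-<) (dominated js∈′))

centred-top : ∀ {k} f us ws {c} → Centred c (labelled f (us ++ fromℕ k ∷ ws)) → c ≡ f (length us)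
centred-top f us ws (r , cr∈ , dominated) with dominated (∈-labelled-middle f us (fromℕ _) ws)
... | inj₁ middle≡c = sym middle≡c
... | inj₂ top<r    = contradiction (Fin.≤fromℕ r) (<⇒≱ top<r)

module _ {n : ℕ} (ℓ : RowLengths n) (π : Vec (Fin n) n) (m c : ℕ) where

  record Occurrence (cs : List (Fin n)) : Set where
    field
      increasing : Increasing cs
      length≡    : length cs ≡ m
      centred    : Centred c (labelled suc (map (lookup π) cs))
      inside     : ∀ {c₁ c₂} → c₁ ∈ cs → c₂ ∈ cs → toℕ c₂ < ℓ (lookup π c₁)

  private
    labels≡ : ∀ {cs} → length cs ≡ m →
              zip (map suc (upTo m)) (map (lookup π) cs) ≡ labelled suc (map (lookup π) cs)
    labels≡ {cs} len≡ = cong (λ is → zip is (map (lookup π) cs))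
      (trans (map-upTo suc m) (cong (applyUpTo suc) (sym (trans (length-map (lookup π) cs) len≡))))

  containsQ⇔ : T (containsQOf ℓ π m c) ⇔ ∃ Occurrence
  containsQ⇔ = mk⇔
    (λ h → let cs , cs∈ , occ = find (any⁻ _ _ h)
               inc , len≡ = ∈-choose-allFin⁻ m cs∈
               centred , inside = to T-∧ occ
           in cs , record
             { increasing = inc
             ; length≡    = len≡
             ; centred    = to (T-centre c _) (subst (T ∘ centre c) (labels≡ len≡) centred)
             ; inside     = λ c₁∈ c₂∈ → <ᵇ⇒< _ _ (All.lookup (All.all⁺ _ _
                              (All.lookup (All.all⁺ _ _ inside) (∈-map⁺ (lookup π) c₁∈))) c₂∈)
             })
    (λ { (cs , o) → let open Occurrence {cs} o in
      any⁺ _ (lose (subst (λ k → cs ∈ choose k (allFin n)) length≡ (∈-choose-allFin⁺ increasing))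
        (from T-∧ ( subst (T ∘ centre c) (sym (labels≡ length≡)) (from (T-centre c _) centred)
                  , All.all⁻ _ (All.tabulate λ r∈ → case ∈-map⁻ (lookup π) r∈ of λ where
                      (c₁ , c₁∈ , refl) → All.all⁻ _ (All.tabulate λ c₂∈ → <⇒<ᵇ (inside c₁∈ c₂∈)))))) })

-- Deleting the top row

Decreasing : ∀ {n} → RowLengths n → Set
Decreasing ℓ = ∀ r r′ → toℕ r ≤ toℕ r′ → ℓ r′ ≤ ℓ r

Bounded : ∀ {n} → RowLengths n → Set
Bounded {n} ℓ = ∀ r → ℓ r ≤ n

module _ {n : ℕ} where

  top : Fin (suc n)
  top = fromℕ n

  -- The rows left after deleting the top row and a column meeting it; since rows
  -- are at least as long as the top one, every row loses one cell.
  shrink : RowLengths (suc n) → RowLengths n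
  shrink ℓ r = ℓ (inject₁ r) ∸ 1

  shrink-decreasing : {ℓ : RowLengths (suc n)} → Decreasing ℓ → Decreasing (shrink ℓ)
  shrink-decreasing dec r r′ r≤r′ = ∸-monoˡ-≤ 1 (dec (inject₁ r) (inject₁ r′)
    (subst₂ _≤_ (sym (Fin.toℕ-inject₁ r)) (sym (Fin.toℕ-inject₁ r′)) r≤r′))

  shrink-bounded : {ℓ : RowLengths (suc n)} → Bounded ℓ → Bounded (shrink ℓ)
  shrink-bounded bnd r = ∸-monoˡ-≤ 1 (bnd (inject₁ r))

  top-shortest : {ℓ : RowLengths (suc n)} → Decreasing ℓ → ∀ r → ℓ top ≤ ℓ r
  top-shortest dec r = dec r top (≤-trans (Fin.toℕ≤pred[n] r) (≤-reflexive (sym (Fin.toℕ-fromℕ n))))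

  deleteTop : Fin (suc n) → Vec (Fin (suc n)) (suc n) → Vec (Fin n) n
  deleteTop x π = V.tabulate (λ c → lower₁-or c (lookup π (punchIn x c)))

  insertTop : Fin (suc n) → Vec (Fin n) n → Vec (Fin (suc n)) (suc n)
  insertTop x π = V.insertAt (V.map inject₁ π) x top

  lookup-insertTop : (x : Fin (suc n)) (π : Vec (Fin n) n) → lookup (insertTop x π) x ≡ top
  lookup-insertTop x π = V.insertAt-lookup _ x _

  lookup-insertTop-punchIn : (x : Fin (suc n)) (π : Vec (Fin n) n) (c : Fin n) →
                             lookup (insertTop x π) (punchIn x c) ≡ inject₁ (lookup π c)
  lookup-insertTop-punchIn x π c = trans (V.insertAt-punchIn _ x _ c) (V.lookup-map c inject₁ π)

  deleteTop-insertTop : (x : Fin (suc n)) (π : Vec (Fin n) n) → deleteTop x (insertTop x π) ≡ π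
  deleteTop-insertTop x π = vec-ext λ c → begin
    lookup (deleteTop x (insertTop x π)) c                ≡⟨ V.lookup∘tabulate _ c ⟩
    lower₁-or c (lookup (insertTop x π) (punchIn x c))    ≡⟨ cong (lower₁-or c) (lookup-insertTop-punchIn x π c) ⟩
    lower₁-or c (inject₁ (lookup π c))                    ≡⟨ lower₁-or-inject₁ c _ ⟩
    lookup π c                                            ∎
    where open ≡-Reasoning

  insertTop-injective : (x : Fin (suc n)) {π : Vec (Fin n) n} →
                        Injective _≡_ _≡_ (lookup π) → Injective _≡_ _≡_ (lookup (insertTop x π))
  insertTop-injective x {π} inj {c₁} {c₂} eq with ≡-or-punchIn x c₁ | ≡-or-punchIn x c₂
  ... | inj₁ refl | inj₁ refl = refl
  ... | inj₁ refl | inj₂ (c₂′ , refl) = contradiction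
          (trans (sym (lookup-insertTop x π)) (trans eq (lookup-insertTop-punchIn x π c₂′))) Fin.fromℕ≢inject₁
  ... | inj₂ (c₁′ , refl) | inj₁ refl = contradiction
          (trans (sym (lookup-insertTop x π)) (trans (sym eq) (lookup-insertTop-punchIn x π c₁′))) Fin.fromℕ≢inject₁
  ... | inj₂ (c₁′ , refl) | inj₂ (c₂′ , refl) = cong (punchIn x) (inj (Fin.inject₁-injective
          (trans (sym (lookup-insertTop-punchIn x π c₁′)) (trans eq (lookup-insertTop-punchIn x π c₂′)))))

  insertTop-inBoard : {ℓ : RowLengths (suc n)} (x : Fin (suc n)) {π : Vec (Fin n) n} →
                      toℕ x < ℓ top → InBoard (shrink ℓ) π → InBoard ℓ (insertTop x π)
  insertTop-inBoard {ℓ} x {π} x<L inb c with ≡-or-punchIn x c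
  ... | inj₁ refl = subst (λ r → toℕ x < ℓ r) (sym (lookup-insertTop x π)) x<L
  ... | inj₂ (c′ , refl) = subst (λ r → toℕ (punchIn x c′) < ℓ r) (sym (lookup-insertTop-punchIn x π c′))
                              (≤-<-trans (toℕ-punchIn-≤ x c′) (<∸1⇒suc< (inb c′)))

module _ {n : ℕ} where

  topColumn : Vec (Fin (suc n)) (suc n) → Fin (suc n)
  topColumn π with Fin.any? (λ c → lookup π c Fin.≟ top)
  ... | yes (c , _) = c
  ... | no _        = Fin.zero

  lookup-topColumn : (π : Vec (Fin (suc n)) (suc n)) → (∃ λ c → lookup π c ≡ top) →
                     lookup π (topColumn π) ≡ top
  lookup-topColumn π attained with Fin.any? (λ c → lookup π c Fin.≟ top)
  ... | yes (_ , πc≡top) = πc≡top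
  ... | no unattained    = contradiction attained unattained

  top-attained : (π : Vec (Fin (suc n)) (suc n)) → Injective _≡_ _≡_ (lookup π) → ∃ λ c → lookup π c ≡ top
  top-attained π inj with c , _ , top≤πc ← Fin.injective⇒existsPivot inj top =
    c , Fin.toℕ-injective (≤-antisym (≤-trans (Fin.toℕ≤pred[n] (lookup π c)) (≤-reflexive (sym (Fin.toℕ-fromℕ n))))
                                      top≤πc)

  topColumn-insertTop : (x : Fin (suc n)) (π : Vec (Fin n) n) → topColumn (insertTop x π) ≡ x
  topColumn-insertTop x π with ≡-or-punchIn x (topColumn (insertTop x π))
  ... | inj₁ eq = eq
  ... | inj₂ (c′ , eq) = contradiction
          (trans (sym (lookup-topColumn (insertTop x π) (x , lookup-insertTop x π)))
                 (trans (cong (lookup (insertTop x π)) eq) (lookup-insertTop-punchIn x π c′)))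
          Fin.fromℕ≢inject₁

-- A 1 in column x of a top row of length L centres an occurrence of Q^(m)_c exactly when
-- the c - 1 columns to its left and the m - c columns to its right fit into the top row
-- (the 1s in those columns all lie lower, in rows at least as long).
TopFits : (m L x c : ℕ) → Set
TopFits m L x c = c ≤ suc x × suc x + (m ∸ c) ≤ L

topFits? : (m L x c : ℕ) → Bool
topFits? m L x c = (c ≤ᵇ suc x) ∧ (suc x + (m ∸ c) ≤ᵇ L)

T-topFits : ∀ m L x c → T (topFits? m L x c) ⇔ TopFits m L x c
T-topFits m L x c = mk⇔ (λ h → let c≤ , fits = to T-∧ h in ≤ᵇ⇒≤ _ _ c≤ , ≤ᵇ⇒≤ _ _ fits)
                        (λ (c≤ , fits) → from T-∧ (≤⇒≤ᵇ c≤ , ≤⇒≤ᵇ fits))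

forbidden : (m L x : ℕ) → List ℕ → Bool
forbidden m L x cs = any (topFits? m L x) cs

allowedColumn : ∀ {k} (m L : ℕ) → List ℕ → Fin k → Bool
allowedColumn m L cs x = (toℕ x <ᵇ L) ∧ not (forbidden m L (toℕ x) cs)

Centres : ℕ → List ℕ → Set
Centres m cs = ∀ {c} → c ∈ cs → 1 ≤ c × c ≤ m

module TopRow {n : ℕ} (π : Vec (Fin (suc n)) (suc n)) (π-inj : Injective _≡_ _≡_ (lookup π))
              (x : Fin (suc n)) (πx≡top : lookup π x ≡ top) where

  π′ : Vec (Fin n) n
  π′ = deleteTop x π

  below-top : ∀ {c} → c ≢ x → toℕ (lookup π c) < n
  below-top {c} c≢x = ≤∧≢⇒< (Fin.toℕ≤pred[n] (lookup π c))
    (λ πc≡n → c≢x (π-inj (trans (Fin.toℕ-injective (trans πc≡n (sym (Fin.toℕ-fromℕ n)))) (sym πx≡top))))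

  inject₁-deleteTop : ∀ c → inject₁ (lookup π′ c) ≡ lookup π (punchIn x c)
  inject₁-deleteTop c = trans (cong inject₁ (V.lookup∘tabulate _ c))
                              (inject₁-lower₁-or c _ (below-top (Fin.punchInᵢ≢i x c)))

  deleteTop-injective : Injective _≡_ _≡_ (lookup π′)
  deleteTop-injective {c} {c′} eq = Fin.punchIn-injective x c c′
    (π-inj (trans (sym (inject₁-deleteTop c)) (trans (cong inject₁ eq) (inject₁-deleteTop c′))))

  insertTop-deleteTop : insertTop x π′ ≡ π
  insertTop-deleteTop = vec-ext λ c → case ≡-or-punchIn x c of λ where
    (inj₁ refl)        → trans (lookup-insertTop x _) (sym πx≡top)
    (inj₂ (c′ , refl)) → trans (lookup-insertTop-punchIn x _ c′) (inject₁-deleteTop c′)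

  rows-punchIn : ∀ cs′ → map (lookup π) (map (punchIn x) cs′) ≡ map inject₁ (map (lookup π′) cs′)
  rows-punchIn cs′ = trans (sym (map-∘ cs′)) (trans (map-cong (sym ∘ inject₁-deleteTop) cs′) (map-∘ cs′))

  rows-through-x : ∀ pre post →
                   map (lookup π) (pre ++ x ∷ post) ≡ map (lookup π) pre ++ top ∷ map (lookup π) post
  rows-through-x pre post =
    trans (map-++ (lookup π) pre (x ∷ post)) (cong (λ r → map (lookup π) pre ++ r ∷ _) πx≡top)

  centred-punchIn : ∀ c cs′ → Centred c (labelled suc (map (lookup π) (map (punchIn x) cs′)))
                            ⇔ Centred c (labelled suc (map (lookup π′) cs′))
  centred-punchIn c cs′ =
    subst (λ irs → Centred c irs ⇔ Centred c (labelled suc (map (lookup π′) cs′)))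
          (sym (trans (cong (labelled suc) (rows-punchIn cs′)) (labelled-map suc inject₁ _)))
          (Centred-map inject₁ inject₁-<⇔ c _)

  module _ {ℓ : RowLengths (suc n)} (dec : Decreasing ℓ) (inb : InBoard ℓ π) where

    x<top : toℕ x < ℓ top
    x<top = subst (λ r → toℕ x < ℓ r) πx≡top (inb x)

    -- Columns to the left of x fit in every row because they fit in the top row.
    punchIn-fits : ∀ c r → toℕ (punchIn x c) < ℓ r → suc (toℕ c) < ℓ r
    punchIn-fits c r fits with toℕ c <? toℕ x
    ... | yes c<x = <-≤-trans (≤-<-trans c<x x<top) (top-shortest dec r)
    ... | no c≮x  = subst (_< ℓ r) (toℕ-punchIn-≥ x c (≮⇒≥ c≮x)) fits

    deleteTop-inBoard : InBoard (shrink ℓ) π′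
    deleteTop-inBoard c = subst (λ r → toℕ c < ℓ r ∸ 1) (sym (inject₁-deleteTop c))
      (suc<⇒<∸1 (punchIn-fits c _ (inb (punchIn x c))))

    occurrence-punchIn : ∀ {m c cs′} → Occurrence (shrink ℓ) π′ m c cs′ →
                         Occurrence ℓ π m c (map (punchIn x) cs′)
    occurrence-punchIn {m} {c} {cs′} o = record
      { increasing = AllPairs.map⁺ (AllPairs.map (from (punchIn-<⇔ x)) increasing)
      ; length≡    = trans (length-map (punchIn x) cs′) length≡
      ; centred    = from (centred-punchIn c cs′) centred
      ; inside     = λ c₁∈ c₂∈ → case ∈-map⁻ (punchIn x) c₁∈ , ∈-map⁻ (punchIn x) c₂∈ of λ where
          ((c₁′ , c₁′∈ , refl) , (c₂′ , c₂′∈ , refl)) →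
            subst (λ r → toℕ (punchIn x c₂′) < ℓ r) (inject₁-deleteTop c₁′)
                  (≤-<-trans (toℕ-punchIn-≤ x c₂′) (<∸1⇒suc< (inside c₁′∈ c₂′∈)))
      }
      where open Occurrence o

    occurrence-unpunchIn : ∀ {m c cs′} → Occurrence ℓ π m c (map (punchIn x) cs′) →
                           Occurrence (shrink ℓ) π′ m c cs′
    occurrence-unpunchIn {m} {c} {cs′} o = record
      { increasing = AllPairs.map (to (punchIn-<⇔ x)) (AllPairs.map⁻ increasing)
      ; length≡    = trans (sym (length-map (punchIn x) cs′)) length≡
      ; centred    = to (centred-punchIn c cs′) centred
      ; inside     = λ {c₁} {c₂} c₁∈ c₂∈ →
          subst (λ r → toℕ c₂ < ℓ r ∸ 1) (sym (inject₁-deleteTop c₁))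
                (suc<⇒<∸1 (punchIn-fits c₂ _ (inside (∈-map⁺ (punchIn x) c₁∈) (∈-map⁺ (punchIn x) c₂∈))))
      }
      where open Occurrence o

    occurrence-through-top : ∀ {m c cs} → x ∈ cs → Occurrence ℓ π m c cs → TopFits m (ℓ top) (toℕ x) c
    occurrence-through-top {m} {c} x∈cs o
      with pre , post , refl ← ∈-∃++ x∈cs
      with pre-inc , pre<x , x<post , post-inc ← AllPairs-middle⁻ pre (Occurrence.increasing o) =
      subst (_≤ suc (toℕ x)) (sym c≡) (s≤s |pre|≤x) ,
      subst (λ k → suc (toℕ x) + k ≤ ℓ top) (sym m∸c≡) post-fits
      where
      open Occurrence o
      c≡ : c ≡ suc (length pre)
      c≡ = trans (centred-top suc (map (lookup π) pre) (map (lookup π) post)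
                   (subst (Centred c ∘ labelled suc) (rows-through-x pre post) centred))
                 (cong suc (length-map (lookup π) pre))
      |pre|≤x : length pre ≤ toℕ x
      |pre|≤x = length-increasing-≤ toℕ pre z≤n pre-inc (All.map (z≤n ,_) pre<x)
      post-fits : suc (toℕ x) + length post ≤ ℓ top
      post-fits = length-increasing-≤ toℕ post x<top post-inc (All.tabulate λ {j} j∈ →
        All.lookup x<post j∈ ,
        subst (λ r → toℕ j < ℓ r) πx≡top (inside (∈-++⁺ʳ pre (here refl)) (∈-++⁺ʳ pre (there j∈))))
      m∸c≡ : m ∸ c ≡ length post
      m∸c≡ = begin
        m ∸ c                                              ≡⟨ cong₂ _∸_ (sym length≡) c≡ ⟩
        length (pre ++ x ∷ post) ∸ suc (length pre)        ≡⟨ cong (_∸ suc (length pre)) (trans (length-++ pre) (+-suc _ _)) ⟩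
        suc (length pre) + length post ∸ suc (length pre)  ≡⟨ m+n∸m≡n (suc (length pre)) _ ⟩
        length post                                        ∎
        where open ≡-Reasoning

    module _ (bnd : Bounded ℓ) where

      topFits⇒occurrence : ∀ m c → 1 ≤ c → c ≤ m → TopFits m (ℓ top) (toℕ x) c → ∃ (Occurrence ℓ π m c)
      topFits⇒occurrence m c 1≤c c≤m (c≤suc[x] , fits)
        with pre , post , |pre|≡pred[c] , |post|≡m∸c , inc , ≤x+m∸c
               ← fin-window x (pred c) (m ∸ c) (∸-monoˡ-≤ 1 c≤suc[x]) (≤-trans fits (bnd top)) =
        pre ++ x ∷ post , record
          { increasing = inc
          ; length≡    = begin
              length (pre ++ x ∷ post)        ≡⟨ length-++ pre ⟩
              length pre + suc (length post)  ≡⟨ cong₂ (λ a b → a + suc b) |pre|≡pred[c] |post|≡m∸c ⟩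
              pred c + suc (m ∸ c)            ≡⟨ trans (+-suc (pred c) _) (cong (_+ (m ∸ c)) suc[pred[c]]≡c) ⟩
              c + (m ∸ c)                     ≡⟨ m+[n∸m]≡n c≤m ⟩
              m                               ∎
          ; centred    = subst₂ (λ c′ rs → Centred c′ (labelled suc rs))
                           (trans (cong suc (trans (length-map (lookup π) pre) |pre|≡pred[c])) suc[pred[c]]≡c)
                           (sym (rows-through-x pre post))
                           (centred-middle suc (map (lookup π) pre) top (map (lookup π) post)
                             (let _ , pre<x , x<post , _ = AllPairs-middle⁻ pre inc in
                              All.++⁺ (All.map⁺ (All.map (<top ∘ Fin.<⇒≢) pre<x))
                                      (All.map⁺ (All.map (<top ∘ ≢-sym ∘ Fin.<⇒≢) x<post))))
          ; inside     = λ {c₁} _ c₂∈ →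
              <-≤-trans (s≤s (All.lookup ≤x+m∸c c₂∈)) (≤-trans fits (top-shortest dec (lookup π c₁)))
          }
        where
        open ≡-Reasoning
        suc[pred[c]]≡c : suc (pred c) ≡ c
        suc[pred[c]]≡c = suc-pred c {{>-nonZero 1≤c}}
        <top : ∀ {j} → j ≢ x → lookup π j Fin.< top
        <top j≢x = subst (toℕ (lookup π _) <_) (sym (Fin.toℕ-fromℕ n)) (below-top j≢x)

      containsQ-deleteTop : ∀ m c → 1 ≤ c → c ≤ m →
        containsQOf ℓ π m c ≡ (topFits? m (ℓ top) (toℕ x) c ∨ containsQOf (shrink ℓ) π′ m c)
      containsQ-deleteTop m c 1≤c c≤m = T-injective (mk⇔ through-or-below top-or-below)
        where
        through-or-below : T (containsQOf ℓ π m c) → T (topFits? m (ℓ top) (toℕ x) c ∨ containsQOf (shrink ℓ) π′ m c)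
        through-or-below h with cs , o ← to (containsQ⇔ ℓ π m c) h | Any.any? (x Fin.≟_) cs
        ... | yes x∈cs = from T-∨ (inj₁ (from (T-topFits m (ℓ top) (toℕ x) c) (occurrence-through-top x∈cs o)))
        ... | no  x∉cs with cs′ , refl ← unpunchIn x x∉cs =
          from T-∨ (inj₂ (from (containsQ⇔ (shrink ℓ) π′ m c) (cs′ , occurrence-unpunchIn o)))
        top-or-below : T (topFits? m (ℓ top) (toℕ x) c ∨ containsQOf (shrink ℓ) π′ m c) → T (containsQOf ℓ π m c)
        top-or-below h = from (containsQ⇔ ℓ π m c) (case to T-∨ h of λ where
          (inj₁ fits) → topFits⇒occurrence m c 1≤c c≤m (to (T-topFits m (ℓ top) (toℕ x) c) fits)
          (inj₂ h′)   → let cs′ , o′ = to (containsQ⇔ (shrink ℓ) π′ m c) h′ in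
                        map (punchIn x) cs′ , occurrence-punchIn o′)

      avoidsAll-deleteTop : ∀ m cs → Centres m cs →
        avoidsAllOf ℓ m cs π ≡ not (forbidden m (ℓ top) (toℕ x) cs) ∧ avoidsAllOf (shrink ℓ) m cs π′
      avoidsAll-deleteTop m []       _  = refl
      avoidsAll-deleteTop m (c ∷ cs) ok =
        trans (cong₂ (λ b rest → not b ∧ rest)
                     (containsQ-deleteTop m c (proj₁ (ok (here refl))) (proj₂ (ok (here refl))))
                     (avoidsAll-deleteTop m cs (ok ∘ there)))
              (interchange (topFits? m (ℓ top) (toℕ x) c) _ (forbidden m (ℓ top) (toℕ x) cs))
        where
        interchange : ∀ a b u {v} → not (a ∨ b) ∧ (not u ∧ v) ≡ not (a ∨ u) ∧ (not b ∧ v)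
        interchange true  _     _     = refl
        interchange false true  true  = refl
        interchange false true  false = refl
        interchange false false _     = refl

module _ {n : ℕ} {ℓ : RowLengths (suc n)} (dec : Decreasing ℓ) (bnd : Bounded ℓ)
         (m : ℕ) (cs : List ℕ) (ok : Centres m cs) where

  private
    allowed : Fin (suc n) → Bool
    allowed = allowedColumn m (ℓ top) cs

    good : ∀ {k} → RowLengths k → Vec (Fin k) k → Bool
    good ℓ′ π = isTransversalOf ℓ′ π ∧ avoidsAllOf ℓ′ m cs π

    split : Vec (Fin (suc n)) (suc n) → Fin (suc n) × Vec (Fin n) n
    split π = topColumn π , deleteTop (topColumn π) π

    merge : Fin (suc n) × Vec (Fin n) n → Vec (Fin (suc n)) (suc n)
    merge (x , π′) = insertTop x π′

    split-good : ∀ π → T (good ℓ π) →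
                 T (allowed (proj₁ (split π)) ∧ good (shrink ℓ) (proj₂ (split π))) × merge (split π) ≡ π
    split-good π h
      with isT , avoids ← to T-∧ h
      with inb , inj ← to (isTransversal⇔ ℓ π) isT
      with πx≡top ← lookup-topColumn π (top-attained π inj)
      with x-allowed , avoids′ ← to T-∧ (subst T (TopRow.avoidsAll-deleteTop π inj _ πx≡top dec inb bnd m cs ok) avoids) =
      from T-∧ (from T-∧ (<⇒<ᵇ (x<top dec inb) , x-allowed) ,
                from T-∧ (from (isTransversal⇔ (shrink ℓ) π′) (deleteTop-inBoard dec inb , deleteTop-injective) , avoids′)) ,
      insertTop-deleteTop
      where open TopRow π inj (topColumn π) πx≡top

    merge-good : ∀ xπ′ → T (allowed (proj₁ xπ′) ∧ good (shrink ℓ) (proj₂ xπ′)) →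
                 T (good ℓ (merge xπ′)) × split (merge xπ′) ≡ xπ′
    merge-good (x , π′) h
      with x-ok , good′ ← to T-∧ h
      with x<L , x-allowed ← to T-∧ x-ok
      with isT′ , avoids′ ← to T-∧ good′
      with inb′ , inj′ ← to (isTransversal⇔ (shrink ℓ) π′) isT′ =
      from T-∧ (from (isTransversal⇔ ℓ (insertTop x π′)) transversal ,
                subst T (sym (trans (TopRow.avoidsAll-deleteTop (insertTop x π′) (proj₂ transversal) x (lookup-insertTop x π′)
                                       dec (proj₁ transversal) bnd m cs ok)
                                    (cong (λ π″ → _ ∧ avoidsAllOf (shrink ℓ) m cs π″) (deleteTop-insertTop x π′))))
                        (from T-∧ (x-allowed , avoids′))) ,
      trans (cong (λ y → y , deleteTop y (insertTop x π′)) (topColumn-insertTop x π′))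
            (cong (x ,_) (deleteTop-insertTop x π′))
      where
      transversal : IsTransversal ℓ (insertTop x π′)
      transversal = insertTop-inBoard {ℓ = ℓ} x (<ᵇ⇒< _ _ x<L) inb′ , insertTop-injective x inj′

  countAvoid-deleteTop : countAvoidOf ℓ m cs ≡ count (allowedColumn m (ℓ top) cs) (allFin (suc n)) * countAvoidOf (shrink ℓ) m cs
  countAvoid-deleteTop = begin
    countAvoidOf ℓ m cs
      ≡⟨ count-filter (isTransversalOf ℓ) (avoidsAllOf ℓ m cs) (allVecs (allFin (suc n)) (suc n)) ⟩
    count (good ℓ) (allVecs (allFin (suc n)) (suc n))
      ≡⟨ count-bijection (good ℓ) (λ z → allowed (proj₁ z) ∧ good (shrink ℓ) (proj₂ z))
           (allVecs-unique _ (Unique.allFin⁺ (suc n)) (suc n))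
           (Unique.cartesianProduct⁺ (Unique.allFin⁺ (suc n)) (allVecs-unique _ (Unique.allFin⁺ n) n))
           (∈-allVecs _ ∈-allFin)
           (λ (x , π′) → ∈-cartesianProduct⁺ (∈-allFin x) (∈-allVecs _ ∈-allFin π′))
           split merge split-good merge-good ⟩
    count (λ z → allowed (proj₁ z) ∧ good (shrink ℓ) (proj₂ z))
          (cartesianProduct (allFin (suc n)) (allVecs (allFin n) n))
      ≡⟨ count-cartesianProduct allowed (good (shrink ℓ)) (allFin (suc n)) (allVecs (allFin n) n) ⟩
    count allowed (allFin (suc n)) * count (good (shrink ℓ)) (allVecs (allFin n) n)
      ≡⟨ cong (count allowed (allFin (suc n)) *_)
              (count-filter (isTransversalOf (shrink ℓ)) (avoidsAllOf (shrink ℓ) m cs) (allVecs (allFin n) n)) ⟨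
    count allowed (allFin (suc n)) * countAvoidOf (shrink ℓ) m cs
      ∎
    where open ≡-Reasoning

-- Columns available to the top row

map-toℕ-allFin : ∀ k → map toℕ (allFin k) ≡ upTo k
map-toℕ-allFin zero    = refl
map-toℕ-allFin (suc k) = cong (0 ∷_) (begin
  map toℕ (tabulate Fin.suc)     ≡⟨ List.map-tabulate Fin.suc toℕ ⟩
  tabulate (suc ∘ toℕ)           ≡⟨ List.map-tabulate toℕ suc ⟨
  map suc (tabulate toℕ)         ≡⟨ cong (map suc) (List.map-tabulate (λ i → i) toℕ) ⟨
  map suc (map toℕ (allFin k))   ≡⟨ cong (map suc) (map-toℕ-allFin k) ⟩
  map suc (upTo k)               ≡⟨ map-upTo suc k ⟩
  applyUpTo suc k                ∎)
  where open ≡-Reasoning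

count-allFin-below : ∀ {k} (p : ℕ → Bool) {L} → L ≤ k →
                     count (λ i → (toℕ i <ᵇ L) ∧ not (p (toℕ i))) (allFin k) ≡ L ∸ count p (upTo L)
count-allFin-below {k} p {L} L≤k = begin
  count (P ∘ toℕ) (allFin k)                             ≡⟨ count-map P toℕ (allFin k) ⟨
  count P (map toℕ (allFin k))                           ≡⟨ cong (count P) (map-toℕ-allFin k) ⟩
  count P (upTo k)                                       ≡⟨ cong (count P ∘ upTo) (m+[n∸m]≡n L≤k) ⟨
  count P (upTo (L + (k ∸ L)))                           ≡⟨ count-upTo-+ P L (k ∸ L) ⟩
  count P (upTo L) + count (P ∘ (L +_)) (upTo (k ∸ L))   ≡⟨ cong₂ _+_ (count-cong (upTo L) below) (count-none _ (upTo (k ∸ L)) beyond) ⟩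
  count (not ∘ p) (upTo L) + 0                           ≡⟨ +-identityʳ _ ⟩
  count (not ∘ p) (upTo L)                               ≡⟨ m+n∸m≡n (count p (upTo L)) _ ⟨
  count p (upTo L) + count (not ∘ p) (upTo L) ∸ count p (upTo L)
                                                         ≡⟨ cong (_∸ count p (upTo L)) (trans (count-complement p (upTo L)) (List.length-upTo L)) ⟩
  L ∸ count p (upTo L)                                   ∎
  where
  open ≡-Reasoning
  P : ℕ → Bool
  P v = (v <ᵇ L) ∧ not (p v)
  below : ∀ {v} → v ∈ upTo L → P v ≡ not (p v)
  below {v} v∈ = cong (_∧ not (p v)) (to T-≡ (<⇒<ᵇ (∈-upTo⁻ v∈)))
  beyond : ∀ {v} → v ∈ upTo (k ∸ L) → ¬ T (P (L + v))
  beyond {v} _ h = <⇒≱ (<ᵇ⇒< _ _ (proj₁ (to T-∧ h))) (m≤m+n L v)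

m∸c≡s+[m∸[s+c]] : ∀ m s c → s + c ≤ m → m ∸ c ≡ s + (m ∸ (s + c))
m∸c≡s+[m∸[s+c]] m s c s+c≤m = begin
  m ∸ c                   ≡⟨ cong (_∸ c) (m+[n∸m]≡n s+c≤m) ⟨
  s + c + t ∸ c           ≡⟨ cong (_∸ c) (trans (cong (_+ t) (+-comm s c)) (+-assoc c s t)) ⟩
  c + (s + t) ∸ c         ≡⟨ m+n∸m≡n c (s + t) ⟩
  s + t                   ∎
  where
  open ≡-Reasoning
  t = m ∸ (s + c)

topFits?-shift : ∀ m L s v c → s + c ≤ m → topFits? m L (s + v) (s + c) ≡ topFits? m L v c
topFits?-shift m L s v c s+c≤m = cong₂ _∧_
  (T-injective (mk⇔ (λ h → ≤⇒≤ᵇ (+-cancelˡ-≤ s c (suc v) (≤-trans (≤ᵇ⇒≤ _ _ h) (≤-reflexive (sym (+-suc s v))))))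
                    (λ h → ≤⇒≤ᵇ (≤-trans (+-monoʳ-≤ s (≤ᵇ⇒≤ _ _ h)) (≤-reflexive (+-suc s v))))))
  (cong (_≤ᵇ L) (begin
    suc (s + v) + (m ∸ (s + c))   ≡⟨ cong suc (trans (cong (_+ t) (+-comm s v)) (+-assoc v s t)) ⟩
    suc v + (s + t)               ≡⟨ cong (suc v +_) (m∸c≡s+[m∸[s+c]] m s c s+c≤m) ⟨
    suc v + (m ∸ c)               ∎))
  where
  open ≡-Reasoning
  t = m ∸ (s + c)

forbidden-shift : ∀ m L s v cs → (∀ {c} → c ∈ cs → s + c ≤ m) →
                  forbidden m L (s + v) (map (s +_) cs) ≡ forbidden m L v cs
forbidden-shift m L s v cs fits = cong or (begin
  map (topFits? m L (s + v)) (map (s +_) cs)            ≡⟨ List.map-∘ cs ⟨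
  map (λ c → topFits? m L (s + v) (s + c)) cs           ≡⟨ List.map-cong-local (All.tabulate (λ c∈ → topFits?-shift m L s v _ (fits c∈))) ⟩
  map (topFits? m L v) cs                               ∎)
  where open ≡-Reasoning

count-forbidden-shift : ∀ m L s cs → (∀ {c} → c ∈ cs → 1 ≤ c × s + c ≤ m) →
  count (λ v → forbidden m L v cs) (upTo L) ≡ count (λ v → forbidden m L v (map (s +_) cs)) (upTo L)
count-forbidden-shift m L s cs ok = count-upTo-translate _ _ s L
  (λ v → forbidden-shift m L s v cs (proj₂ ∘ ok))
  (λ v h → case find (any⁻ _ (map (s +_) cs) h) of λ where
     (c′ , c′∈ , fits) → case ∈-map⁻ (s +_) c′∈ of λ where
       (c , c∈ , refl) → ≤-pred (begin
         suc s      ≡⟨ trans (+-suc s 0) (cong suc (+-identityʳ s)) ⟨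
         s + 1      ≤⟨ +-monoʳ-≤ s (proj₁ (ok c∈)) ⟩
         s + c      ≤⟨ proj₁ (to (T-topFits m L v (s + c)) fits) ⟩
         suc v      ∎))
  (λ v h → case find (any⁻ _ cs h) of λ where
     (c , c∈ , fits) → begin
       suc (s + v)          ≡⟨ cong suc (+-comm s v) ⟩
       suc v + s            ≤⟨ +-monoʳ-≤ (suc v) (≤-trans (m≤m+n s _) (≤-reflexive (sym (m∸c≡s+[m∸[s+c]] m s c (proj₂ (ok c∈)))))) ⟩
       suc v + (m ∸ c)      ≤⟨ proj₂ (to (T-topFits m L v c) fits) ⟩
       L                    ∎)
  where open ≤-Reasoning

module _ (ℓ : RowLengths 0) where

  containsQ-empty : ∀ m c → containsQOf ℓ V.[] m c ≡ false
  containsQ-empty zero    c = refl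
  containsQ-empty (suc m) c = refl

  countAvoid-empty : ∀ m cs → countAvoidOf ℓ m cs ≡ 1
  countAvoid-empty m cs
    rewrite to T-≡ (All.all⁻ _ {cs} (All.tabulate λ {c} _ → from T-not-≡ (containsQ-empty m c))) = refl

countAvoid-shift : ∀ {n} (ℓ : RowLengths n) → Decreasing ℓ → Bounded ℓ →
                   ∀ m s cs → (∀ {c} → c ∈ cs → 1 ≤ c × s + c ≤ m) →
                   countAvoidOf ℓ m cs ≡ countAvoidOf ℓ m (map (s +_) cs)
countAvoid-shift {zero}  ℓ _   _   m s cs _  = trans (countAvoid-empty ℓ m cs) (sym (countAvoid-empty ℓ m (map (s +_) cs)))
countAvoid-shift {suc n} ℓ dec bnd m s cs ok = begin
  countAvoidOf ℓ m cs
    ≡⟨ countAvoid-deleteTop dec bnd m cs in-range ⟩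
  count (allowedColumn m L cs) (allFin (suc n)) * countAvoidOf (shrink ℓ) m cs
    ≡⟨ cong₂ _*_ same-allowed (countAvoid-shift (shrink ℓ) (shrink-decreasing dec) (shrink-bounded bnd) m s cs ok) ⟩
  count (allowedColumn m L (map (s +_) cs)) (allFin (suc n)) * countAvoidOf (shrink ℓ) m (map (s +_) cs)
    ≡⟨ countAvoid-deleteTop dec bnd m (map (s +_) cs) shifted-in-range ⟨
  countAvoidOf ℓ m (map (s +_) cs)
    ∎
  where
  open ≡-Reasoning
  L = ℓ top
  in-range : Centres m cs
  in-range c∈ = proj₁ (ok c∈) , ≤-trans (m≤n+m _ s) (proj₂ (ok c∈))
  shifted-in-range : Centres m (map (s +_) cs)
  shifted-in-range c′∈ with c , c∈ , refl ← ∈-map⁻ (s +_) c′∈ = ≤-trans (proj₁ (ok c∈)) (m≤n+m c s) , proj₂ (ok c∈)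
  same-allowed : count (allowedColumn m L cs) (allFin (suc n)) ≡ count (allowedColumn m L (map (s +_) cs)) (allFin (suc n))
  same-allowed = begin
    count (allowedColumn m L cs) (allFin (suc n))
      ≡⟨ count-allFin-below (λ v → forbidden m L v cs) (bnd top) ⟩
    L ∸ count (λ v → forbidden m L v cs) (upTo L)
      ≡⟨ cong (L ∸_) (count-forbidden-shift m L s cs ok) ⟩
    L ∸ count (λ v → forbidden m L v (map (s +_) cs)) (upTo L)
      ≡⟨ count-allFin-below (λ v → forbidden m L v (map (s +_) cs)) (bnd top) ⟨
    count (allowedColumn m L (map (s +_) cs)) (allFin (suc n))
      ∎

countAvoid-centres-≤ : ∀ {n} (λb : Ferrers n) m k d {a b} → 1 ≤ a → a ≤ b → b + k * d ≤ m →
                       countAvoid λb m k d a ≡ countAvoid λb m k d b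
countAvoid-centres-≤ λb m k d {a} {b} 1≤a a≤b b+kd≤m = begin
  countAvoid λb m k d a                                        ≡⟨ countAvoid-rowLengths λb m k d a ⟩
  countAvoidOf (len λb) m (centres m k d a)                    ≡⟨ countAvoid-shift (len λb) (decreasing λb) (len≤n λb) m (b ∸ a) _ ok ⟩
  countAvoidOf (len λb) m (map ((b ∸ a) +_) (centres m k d a)) ≡⟨ cong (countAvoidOf (len λb) m) shifted ⟩
  countAvoidOf (len λb) m (centres m k d b)                    ≡⟨ countAvoid-rowLengths λb m k d b ⟨
  countAvoid λb m k d b                                        ∎
  where
  open ≡-Reasoning
  shift : ∀ j → (b ∸ a) + (a + j * d) ≡ b + j * d
  shift j = trans (sym (+-assoc (b ∸ a) a (j * d))) (cong (_+ j * d) (m∸n+n≡m a≤b))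
  shifted : map ((b ∸ a) +_) (centres m k d a) ≡ centres m k d b
  shifted = trans (sym (List.map-∘ (upTo (suc k)))) (List.map-cong shift (upTo (suc k)))
  ok : ∀ {c} → c ∈ centres m k d a → 1 ≤ c × (b ∸ a) + c ≤ m
  ok c∈ with j , j∈ , refl ← ∈-map⁻ (λ j → a + j * d) {xs = upTo (suc k)} c∈ =
    ≤-trans 1≤a (m≤m+n a (j * d)) ,
    ≤-trans (≤-reflexive (shift j)) (≤-trans (+-monoʳ-≤ b (*-monoˡ-≤ d (≤-pred (∈-upTo⁻ j∈)))) b+kd≤m)

theorem3 : (m k d a b : ℕ) → 1 ≤ a → a ≤ m → 1 ≤ b → b ≤ m → a ≢ b →
           a + k * d ≤ m → b + k * d ≤ m →
           (n : ℕ) (λb : Ferrers n) →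
           countAvoid λb m k d a ≡ countAvoid λb m k d b
theorem3 m k d a b 1≤a _ 1≤b _ _ a+kd≤m b+kd≤m n λb with ≤-total a b
... | inj₁ a≤b = countAvoid-centres-≤ λb m k d 1≤a a≤b b+kd≤m
... | inj₂ b≤a = sym (countAvoid-centres-≤ λb m k d 1≤b b≤a a+kd≤m)
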